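{- For every integer $n\geq 2$, $\eta_n=\omega(\widehat H_n)$, where $\omega$ denotes the clique number.
   Context: For $f\colon\mathbb F_2^n\to\mathbb F_2$ and $i\in\{1,\ldots,n\}$, let $L_i\colon\mathbb F_2^n\to\mathbb F_2^n$ be $L_i(x_1,\ldots,x_n)=(x_1,\ldots,x_{i-1},f(x_1,\ldots,x_n),x_{i+1},\ldots,x_n)$. With $\mathrm{id}=12\cdots n$ the identity permutation, the SDS map is $F=[K_n,f,\mathrm{id}]=L_n\circ L_{n-1}\circ\cdots\circ L_1$ (the sequential dynamical system on the complete graph $K_n$ in which every vertex has vertex function $f$). The phase space $\Gamma(F)$ is the directed graph on vertex set $\mathbb F_2^n$ with an edge $\vec x\to F(\vec x)$ for each $\vec x$; a $2$-cycle is a set $\{\vec x,F(\vec x)\}$ with $F(\vec x)\neq\vec x$ and $F(F(\vec x))=\vec x$. Let $\eta(f,\mathrm{id})$ be the number of $2$-cycles of $\Gamma([K_n,f,\mathrm{id}])$, and $\eta_n=\max_{f}\eta(f,\mathrm{id})$, the maximum over all functions $f\colon\mathbb F_2^n\to\mathbb F_2$. A vector $(y_1,\ldots,y_n)\in\mathbb F_2^n$ contains the subsequence $101$ if there exist indices $i_1<i_2<i_3$ with $y_{i_1}=1$, $y_{i_2}=0$, $y_{i_3}=1$. The graph $\widehat H_n$ is the simple undirected graph whose vertex set is $\{(x_1,\ldots,x_n)\in\mathbb F_2^n: x_1=0\}$, with $\vec x,\vec y$ adjacent iff $\vec x\neq\vec y$ and $\vec x+\vec y$ contains the subsequence $101$.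 -}

module Defs where

open import Data.Bool using (Bool; true; false; _xor_)
open import Data.Nat using (ℕ; zero; suc; _/_; _≤_; _<_)
open import Data.Fin using (Fin; toℕ; fromℕ<)
import Data.Fin as Fin
open import Data.Vec using (Vec; []; _∷_; lookup; _[_]≔_; zipWith)
open import Data.Vec.Properties using (≡-dec)
open import Data.List using (List; []; _∷_; _++_; map; length; filter)
open import Data.List.Relation.Unary.All using (All)
open import Data.List.Relation.Unary.Unique.Propositional using (Unique)
open import Data.List.Relation.Unary.AllPairs using (AllPairs)
open import Data.Product using (Σ; ∃; _×_; _,_)
open import Relation.Binary.PropositionalEquality using (_≡_; _≢_)
open import Relation.Nullary using (Dec; ¬_)
open import Relation.Nullary.Decidable using (_×-dec_; ¬?)
import Data.Bool.Properties as BoolP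

Vecs : ℕ → Set
Vecs n = Vec Bool n

allVecs : (n : ℕ) → List (Vec Bool n)
allVecs zero = [] ∷ []
allVecs (suc n) = map (false ∷_) (allVecs n) ++ map (true ∷_) (allVecs n)

L : {n : ℕ} → (Vec Bool n → Bool) → Fin n → Vec Bool n → Vec Bool n
L f i x = x [ i ]≔ f x

seqUpdate : {n : ℕ} → (Vec Bool n → Bool) → (k : ℕ) → k ≤ n → Vec Bool n → Vec Bool n
seqUpdate f zero _ x = x
seqUpdate {n} f (suc k) k<n x =
  L f (fromℕ< k<n) (seqUpdate f k (Data.Nat.Properties.<⇒≤ k<n) x)
  where import Data.Nat.Properties

-- SDS map F = [K_n, f, id] = L_n ∘ ⋯ ∘ L_1
SDS : {n : ℕ} → (Vec Bool n → Bool) → Vec Bool n → Vec Bool n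
SDS {n} f = seqUpdate f n (Data.Nat.Properties.≤-refl)
  where import Data.Nat.Properties

_≟v_ : {n : ℕ} → (x y : Vec Bool n) → Dec (x ≡ y)
_≟v_ = ≡-dec BoolP._≟_

OnTwoCycle : {n : ℕ} → (Vec Bool n → Vec Bool n) → Vec Bool n → Set
OnTwoCycle F x = (F x ≢ x) × (F (F x) ≡ x)

onTwoCycle? : {n : ℕ} → (F : Vec Bool n → Vec Bool n) → (x : Vec Bool n) → Dec (OnTwoCycle F x)
onTwoCycle? F x = ¬? (F x ≟v x) ×-dec (F (F x) ≟v x)

-- η(f, id): number of 2-cycles = (number of points on 2-cycles) / 2,
-- since each 2-cycle {x, F x} consists of exactly two points
eta : {n : ℕ} → (Vec Bool n → Bool) → ℕ
eta {n} f = length (filter (onTwoCycle? (SDS f)) (allVecs n)) / 2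

IsEtaMax : ℕ → ℕ → Set
IsEtaMax n m = (Σ (Vec Bool n → Bool) λ f → eta f ≡ m) × ((f : Vec Bool n → Bool) → eta f ≤ m)

Contains101 : {n : ℕ} → Vec Bool n → Set
Contains101 {n} y = Σ (Fin n) λ i → Σ (Fin n) λ j → Σ (Fin n) λ k →
  (i Fin.< j) × (j Fin.< k) × (lookup y i ≡ true) × (lookup y j ≡ false) × (lookup y k ≡ true)

IsVertex : {n : ℕ} → Vec Bool n → Set
IsVertex {n} x = (i : Fin n) → toℕ i ≡ 0 → lookup x i ≡ false

Adj : {n : ℕ} → Vec Bool n → Vec Bool n → Set
Adj x y = (x ≢ y) × Contains101 (zipWith _xor_ x y)

IsClique : {n : ℕ} → List (Vec Bool n) → Set
IsClique c = All IsVertex c × Unique c × AllPairs Adj c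

IsCliqueNumber : ℕ → ℕ → Set
IsCliqueNumber n m = (Σ (List (Vec Bool n)) λ c → IsClique c × length c ≡ m)
  × ((c : List (Vec Bool n)) → IsClique c → length c ≤ m)

module Submission where

-- Write [0,k) for prefix k, the vector whose first k coordinates are 1.  A sweep of the SDS
-- from x to y = F x passes through the states splice k y x (first k coordinates from y, the
-- others from x), and y_k = f (splice k y x).  If moreover F y = x and x_k = y_k, then the k-th
-- and (k+1)-st states of both sweeps coincide, so x and y also agree at k + 1, and agreement at
-- the last coordinate gives agreement at the first.  Hence the 2-cycles are the pairs {x, ¬x}
-- with f (z ⊕ [0,k)) = ¬ z_k for z ∈ {x, ¬x} and every k.  For x and y with first coordinate 0,
-- a state of the cycle through x can only coincide with a state of the cycle through y when
-- x ⊕ y is, up to complement, an interval [k, k′), a word without the subsequence 101.  So the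
-- 2-cycle points with first coordinate 0 form a clique of Ĥ_n, one per 2-cycle (comparing the
-- values of f at coinciding states rules out an interval x ⊕ y), and conversely, for a clique C
-- the states of the cycles {x, ¬x}, x ∈ C, are pairwise distinct, so one f realises them all.

open import Defs
open import Data.Bool using (Bool; true; false; not; _xor_; if_then_else_)
import Data.Bool as Bool
open import Data.Bool.Properties
  using (xor-same; xor-comm; xor-identityʳ; ¬-not; not-¬; not-injective; not-involutive)
open import Data.Bool.Solver using (module xor-∧-Solver)
open xor-∧-Solver using (solve; _:+_; _:=_)
open import Data.Empty using (⊥; ⊥-elim)
open import Data.Fin using (Fin; toℕ; fromℕ; fromℕ<) renaming (zero to fzero; suc to fsuc)
import Data.Fin.Properties as Fin
open import Data.Fin.Properties using (toℕ-fromℕ; toℕ-fromℕ<; fromℕ<-toℕ; toℕ<n; toℕ-injective)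
open import Data.List using (List; []; _∷_; _++_; length; filter; concatMap)
import Data.List as List
open import Data.List.Membership.Propositional using (_∈_; find; lose)
open import Data.List.Membership.Propositional.Properties
  using (∈-++⁻; ∈-++⁺ˡ; ∈-++⁺ʳ; ∈-map⁻; ∈-map⁺; ∈-∃++; ∈-filter⁺; ∈-filter⁻; ∈-concatMap⁺)
open import Data.List.Properties using (length-++; length-map)
open import Data.List.Relation.Unary.All as All using (All; []; _∷_)
open import Data.List.Relation.Unary.All.Properties using (all-filter)
open import Data.List.Relation.Unary.AllPairs as AllPairs using (AllPairs; []; _∷_)
open import Data.List.Relation.Unary.Any using (Any; here; there; any?)
open import Data.List.Relation.Unary.Unique.Propositional using (Unique)
import Data.List.Relation.Unary.Unique.Propositional.Properties as Unique
open import Data.Nat using (ℕ; zero; suc; _+_; _*_; _/_; _≤_; _<_; _<ᵇ_; z≤n; s≤s)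
import Data.Nat as ℕ
open import Data.Nat.DivMod using (m*n/n≡m; /-monoˡ-≤)
open import Data.Nat.Properties
  using ( _<?_; ≤-refl; ≤-reflexive; ≤-trans; ≤-antisym; ≤-pred; ≤-irrelevant; <-irrefl; <-trans
        ; ≤-<-trans; <-≤-trans; <⇒≤; ≤⇒≯; ≮⇒≥; n<1+n; m<n⇒m<1+n; m≤n⇒m<n∨m≡n; <-cmp
        ; +-suc; +-identityʳ; *-comm; ≤-totalOrder; module ≤-Reasoning)
open import Data.List.Extrema ≤-totalOrder using (argmax; argmax-all; f[xs]≤f[argmax])
open import Data.Product using (Σ; _×_; _,_; proj₁; proj₂)
open import Data.Sum using (_⊎_; inj₁; inj₂)
import Data.Sum as Sum
open import Data.Vec using (Vec; []; _∷_; head; lookup; tabulate; zipWith; map; replicate; _[_]≔_)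
open import Data.Vec.Properties
  using ( lookup∘tabulate; tabulate∘lookup; tabulate-cong; lookup-zipWith; lookup-map; lookup-replicate
        ; lookup∘update; lookup∘update′; []≔-lookup; zipWith-comm; map-∘; map-cong; map-id; ∷-injectiveʳ)
open import Function using (_$_; case_of_)
open import Relation.Binary using (tri<; tri≈; tri>)
open import Relation.Binary.PropositionalEquality
open import Relation.Nullary using (Dec; does; yes; no; ¬_)
open import Relation.Nullary.Decidable using (dec-true; dec-false; _×-dec_; _→-dec_; ¬?)

private
  variable
    n : ℕ

false≢true : false ≢ true
false≢true ()

<ᵇ-true : ∀ {m k} → m < k → (m <ᵇ k) ≡ true
<ᵇ-true {m} {k} = dec-true (m <? k)

<ᵇ-false : ∀ {m k} → k ≤ m → (m <ᵇ k) ≡ false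
<ᵇ-false {m} {k} k≤m = dec-false (m <? k) (≤⇒≯ k≤m)

xor≡false⇒≡ : ∀ {a b} → a xor b ≡ false → a ≡ b
xor≡false⇒≡ {false} {false} _ = refl
xor≡false⇒≡ {true}  {true}  _ = refl

xor≡true⇒≢ : ∀ {a b} → a xor b ≡ true → a ≢ b
xor≡true⇒≢ {a} h refl = false≢true (trans (sym (xor-same a)) h)

xor-≢ : ∀ {a b a' b'} → a xor b ≢ a' xor b' → a ≢ a' ⊎ b ≢ b'
xor-≢ {a} {a' = a'} differ with a Bool.≟ a'
... | yes refl = inj₂ λ b≡b' → differ (cong (a xor_) b≡b')
... | no  a≢a' = inj₁ a≢a'

xor-swap : ∀ a b c d → a xor b ≡ c xor d → a xor c ≡ b xor d
xor-swap a b c d h = begin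
  a xor c                 ≡⟨ solve 3 (λ a b c → a :+ c := (a :+ b) :+ (b :+ c)) refl a b c ⟩
  (a xor b) xor (b xor c) ≡⟨ cong (_xor (b xor c)) h ⟩
  (c xor d) xor (b xor c) ≡⟨ solve 3 (λ b c d → (c :+ d) :+ (b :+ c) := b :+ d) refl b c d ⟩
  b xor d                 ∎
  where open ≡-Reasoning

xor-difference : ∀ b x P b' x' Q → (b xor x) xor P ≡ (b' xor x') xor Q → x xor x' ≡ (b xor b') xor (P xor Q)
xor-difference b x P b' x' Q h = begin
  x xor x'                                            ≡⟨ solve 6 (λ b x P b' x' Q →
    x :+ x' := (((b :+ x) :+ P) :+ ((b' :+ x') :+ Q)) :+ ((b :+ b') :+ (P :+ Q))) refl b x P b' x' Q ⟩
  (((b xor x) xor P) xor ((b' xor x') xor Q)) xor D  ≡⟨ cong (λ u → (u xor ((b' xor x') xor Q)) xor D) h ⟩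
  (((b' xor x') xor Q) xor ((b' xor x') xor Q)) xor D ≡⟨ cong (_xor D) (xor-same ((b' xor x') xor Q)) ⟩
  D                                                   ∎
  where
  open ≡-Reasoning
  D : Bool
  D = (b xor b') xor (P xor Q)

lookup-ext : ∀ {A : Set} {u v : Vec A n} → (∀ i → lookup u i ≡ lookup v i) → u ≡ v
lookup-ext {u = u} {v} h = trans (sym (tabulate∘lookup u)) (trans (tabulate-cong h) (tabulate∘lookup v))

infixl 6 _⊕_
_⊕_ : Vec Bool n → Vec Bool n → Vec Bool n
_⊕_ = zipWith _xor_

complement : Vec Bool n → Vec Bool n
complement = map not

prefix : ℕ → Vec Bool n
prefix k = tabulate λ i → toℕ i <ᵇ k

lookup-⊕ : ∀ (x y : Vec Bool n) i → lookup (x ⊕ y) i ≡ lookup x i xor lookup y i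
lookup-⊕ x y i = lookup-zipWith _xor_ i x y

lookup-prefix : ∀ k (i : Fin n) → lookup (prefix k) i ≡ (toℕ i <ᵇ k)
lookup-prefix k = lookup∘tabulate _

lookup-interval : ∀ a b (i : Fin n) → lookup (prefix a ⊕ prefix b) i ≡ (toℕ i <ᵇ a) xor (toℕ i <ᵇ b)
lookup-interval a b i = trans (lookup-⊕ (prefix a) (prefix b) i) (cong₂ _xor_ (lookup-prefix a i) (lookup-prefix b i))

lookup-interval-fromℕ< : ∀ a b {k} (p : k < n) → lookup (prefix a ⊕ prefix b) (fromℕ< p) ≡ (k <ᵇ a) xor (k <ᵇ b)
lookup-interval-fromℕ< a b p =
  subst (λ k → lookup (prefix a ⊕ prefix b) (fromℕ< p) ≡ (k <ᵇ a) xor (k <ᵇ b)) (toℕ-fromℕ< p)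
        (lookup-interval a b (fromℕ< p))

⊕-comm : ∀ (x y : Vec Bool n) → x ⊕ y ≡ y ⊕ x
⊕-comm = zipWith-comm xor-comm

⊕-self : ∀ (x : Vec Bool n) → x ⊕ x ≡ replicate n false
⊕-self x = lookup-ext λ i → trans (lookup-⊕ x x i) (trans (xor-same (lookup x i)) (sym (lookup-replicate i false)))

⊕≡zero⇒≡ : ∀ {x y : Vec Bool n} → x ⊕ y ≡ replicate n false → x ≡ y
⊕≡zero⇒≡ {x = x} {y} eq = lookup-ext λ i →
  xor≡false⇒≡ (trans (sym (lookup-⊕ x y i)) (trans (cong (λ v → lookup v i) eq) (lookup-replicate i false)))

⊕-swap : ∀ {x y u v : Vec Bool n} → x ⊕ y ≡ u ⊕ v → x ⊕ u ≡ y ⊕ v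
⊕-swap {x = x} {y} {u} {v} eq = lookup-ext λ i → begin
  lookup (x ⊕ u) i          ≡⟨ lookup-⊕ x u i ⟩
  lookup x i xor lookup u i ≡⟨ xor-swap (lookup x i) (lookup y i) (lookup u i) (lookup v i) (begin
    lookup x i xor lookup y i ≡⟨ lookup-⊕ x y i ⟨
    lookup (x ⊕ y) i          ≡⟨ cong (λ w → lookup w i) eq ⟩
    lookup (u ⊕ v) i          ≡⟨ lookup-⊕ u v i ⟩
    lookup u i xor lookup v i ∎) ⟩
  lookup y i xor lookup v i ≡⟨ lookup-⊕ y v i ⟨
  lookup (y ⊕ v) i          ∎
  where open ≡-Reasoning

⊕-prefix-zero : (x : Vec Bool n) → x ⊕ prefix 0 ≡ x
⊕-prefix-zero x = lookup-ext λ i →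
  trans (lookup-⊕ x (prefix 0) i) (trans (cong (lookup x i xor_) (lookup-prefix 0 i)) (xor-identityʳ _))

⊕-prefix-all : ∀ {n} (x : Vec Bool n) → x ⊕ prefix n ≡ complement x
⊕-prefix-all {n} x = lookup-ext λ i → begin
  lookup (x ⊕ prefix n) i            ≡⟨ lookup-⊕ x (prefix n) i ⟩
  lookup x i xor lookup (prefix n) i ≡⟨ cong (lookup x i xor_) (trans (lookup-prefix n i) (<ᵇ-true (toℕ<n i))) ⟩
  lookup x i xor true                ≡⟨ xor-comm (lookup x i) true ⟩
  not (lookup x i)                   ≡⟨ lookup-map i not x ⟨
  lookup (complement x) i            ∎
  where open ≡-Reasoning

complement-involutive : (x : Vec Bool n) → complement (complement x) ≡ x
complement-involutive x = trans (sym (map-∘ not not x)) (trans (map-cong not-involutive x) (map-id x))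

complement-injective : ∀ {x y : Vec Bool n} → complement x ≡ complement y → x ≡ y
complement-injective {x = x} {y} eq =
  trans (sym (complement-involutive x)) (trans (cong complement eq) (complement-involutive y))

complement-≢ : ∀ {m} (x : Vec Bool (suc m)) → complement x ≢ x
complement-≢ (b ∷ x) eq = not-¬ refl (sym (cong head eq))

-- Words avoiding the subsequence 101

contains101-∷ : ∀ b {e : Vec Bool n} → Contains101 e → Contains101 (b ∷ e)
contains101-∷ b (i , j , k , i<j , j<k , eᵢ , eⱼ , eₖ) =
  fsuc i , fsuc j , fsuc k , s≤s i<j , s≤s j<k , eᵢ , eⱼ , eₖ

contains101-or-interval : (e : Vec Bool n) →
  Contains101 e ⊎ Σ ℕ λ a → Σ ℕ λ b → a ≤ b × b ≤ n × e ≡ prefix a ⊕ prefix b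
contains101-or-interval [] = inj₂ (0 , 0 , z≤n , z≤n , refl)
contains101-or-interval (bit ∷ e) with contains101-or-interval e
... | inj₁ c = inj₁ (contains101-∷ bit c)
contains101-or-interval (false ∷ e) | inj₂ (a , b , a≤b , b≤n , e≡) =
  inj₂ (suc a , suc b , s≤s a≤b , s≤s b≤n , cong (false ∷_) e≡)
contains101-or-interval (true ∷ e) | inj₂ (zero , b , _ , b≤n , e≡) =
  inj₂ (0 , suc b , z≤n , s≤s b≤n , cong (true ∷_) e≡)
contains101-or-interval {suc n} (true ∷ e) | inj₂ (suc a , b , a<b , b≤n , e≡) with m≤n⇒m<n∨m≡n a<b
... | inj₂ refl = inj₂ (0 , 1 , z≤n , s≤s z≤n , cong (true ∷_) (trans e≡ (trans (⊕-self _) (sym (⊕-self _)))))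
... | inj₁ 1+a<b =
  inj₁ (fzero , fsuc (fromℕ< 0<n) , fsuc (fromℕ< 1+a<n) , s≤s z≤n , s≤s 0<1+a , refl , e₀ , e₁₊ₐ)
  where
  0<n : 0 < n
  0<n = ≤-trans (s≤s z≤n) (≤-trans a<b b≤n)
  1+a<n : suc a < n
  1+a<n = ≤-trans 1+a<b b≤n
  0<1+a : toℕ (fromℕ< 0<n) < toℕ (fromℕ< 1+a<n)
  0<1+a rewrite toℕ-fromℕ< 0<n | toℕ-fromℕ< 1+a<n = s≤s z≤n
  e₀ : lookup e (fromℕ< 0<n) ≡ false
  e₀ = trans (cong (λ v → lookup v (fromℕ< 0<n)) e≡)
    (trans (lookup-interval-fromℕ< (suc a) b 0<n)
           (cong₂ _xor_ (<ᵇ-true (s≤s (z≤n {a}))) (<ᵇ-true (≤-trans (s≤s z≤n) a<b))))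
  e₁₊ₐ : lookup e (fromℕ< 1+a<n) ≡ true
  e₁₊ₐ = trans (cong (λ v → lookup v (fromℕ< 1+a<n)) e≡)
    (trans (lookup-interval-fromℕ< (suc a) b 1+a<n) (cong₂ _xor_ (<ᵇ-false (≤-refl {suc a})) (<ᵇ-true 1+a<b)))

Cut : ℕ → ℕ → ℕ → Set
Cut k p q = p < k × k ≤ q

<ᵇ-change : ∀ {p q k} → p ≤ q → (p <ᵇ k) ≢ (q <ᵇ k) → Cut k p q
<ᵇ-change {p} {q} {k} p≤q differ with p <? k | q <? k
... | yes p<k | yes q<k = ⊥-elim (differ (trans (<ᵇ-true p<k) (sym (<ᵇ-true q<k))))
... | yes p<k | no  q≮k = p<k , ≮⇒≥ q≮k
... | no  p≮k | _       =
  ⊥-elim (differ (trans (<ᵇ-false (≮⇒≥ p≮k)) (sym (<ᵇ-false (≤-trans (≮⇒≥ p≮k) p≤q)))))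

cut-disjoint : ∀ {k p q p' r} → q ≤ p' → Cut k p q → Cut k p' r → ⊥
cut-disjoint q≤p' (_ , k≤q) (p'<k , _) = <-irrefl refl (≤-<-trans (≤-trans k≤q q≤p') p'<k)

two-points-three-cuts : ∀ {k k' a b c d} →
  Cut k a b ⊎ Cut k' a b → Cut k b c ⊎ Cut k' b c → Cut k c d ⊎ Cut k' c d → ⊥
two-points-three-cuts (inj₁ x) (inj₁ y) _        = cut-disjoint ≤-refl x y
two-points-three-cuts (inj₂ x) (inj₂ y) _        = cut-disjoint ≤-refl x y
two-points-three-cuts _        (inj₁ y) (inj₁ z) = cut-disjoint ≤-refl y z
two-points-three-cuts _        (inj₂ y) (inj₂ z) = cut-disjoint ≤-refl y z
two-points-three-cuts (inj₁ x) (inj₂ (b<k' , k'≤c)) (inj₁ z) = cut-disjoint (<⇒≤ (<-≤-trans b<k' k'≤c)) x z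
two-points-three-cuts (inj₂ x) (inj₁ (b<k , k≤c))   (inj₂ z) = cut-disjoint (<⇒≤ (<-≤-trans b<k k≤c)) x z

-- e changes its value only across the cut points k and k′, while 0…1…0…1 needs three changes.
no101-of-two-cuts : ∀ (e : Vec Bool (suc n)) c k k' →
  (∀ i → lookup e i ≡ c xor ((toℕ i <ᵇ k) xor (toℕ i <ᵇ k'))) → lookup e fzero ≡ false → ¬ Contains101 e
no101-of-two-cuts e c k k' e≡ e₀ (i , j , l , i<j , j<l , eᵢ , eⱼ , eₗ) =
  two-points-three-cuts (cut z≤n (opposite e₀ eᵢ))
                        (cut (<⇒≤ i<j) (opposite eᵢ eⱼ))
                        (cut (<⇒≤ j<l) (opposite eⱼ eₗ))
  where
  opposite : ∀ {a b x} → a ≡ x → b ≡ not x → a ≢ b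
  opposite a≡x b≡x̄ a≡b = not-¬ refl (trans (sym a≡x) (trans a≡b b≡x̄))

  cut : ∀ {p q} → toℕ p ≤ toℕ q → lookup e p ≢ lookup e q → Cut k (toℕ p) (toℕ q) ⊎ Cut k' (toℕ p) (toℕ q)
  cut {p} {q} p≤q eₚ≢e_q = Sum.map (<ᵇ-change p≤q) (<ᵇ-change p≤q)
    (xor-≢ λ same → eₚ≢e_q (trans (e≡ p) (trans (cong (c xor_) same) (sym (e≡ q)))))

-- Sweeps of the SDS map

splice : ℕ → Vec Bool n → Vec Bool n → Vec Bool n
splice k y x = tabulate λ i → if toℕ i <ᵇ k then lookup y i else lookup x i

lookup-splice-< : ∀ {k} (y x : Vec Bool n) {i} → toℕ i < k → lookup (splice k y x) i ≡ lookup y i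
lookup-splice-< {k = k} y x {i} i<k
  rewrite lookup∘tabulate (λ j → if toℕ j <ᵇ k then lookup y j else lookup x j) i | <ᵇ-true i<k = refl

lookup-splice-≥ : ∀ {k} (y x : Vec Bool n) {i} → k ≤ toℕ i → lookup (splice k y x) i ≡ lookup x i
lookup-splice-≥ {k = k} y x {i} k≤i
  rewrite lookup∘tabulate (λ j → if toℕ j <ᵇ k then lookup y j else lookup x j) i | <ᵇ-false k≤i = refl

splice-zero : (y x : Vec Bool n) → splice 0 y x ≡ x
splice-zero y x = lookup-ext λ i → lookup-splice-≥ y x z≤n

splice-all : (y x : Vec Bool n) → splice n y x ≡ y
splice-all y x = lookup-ext λ i → lookup-splice-< y x (toℕ<n i)

splice-suc : ∀ {k} (p : k < n) (y x : Vec Bool n) →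
             splice (suc k) y x ≡ splice k y x [ fromℕ< p ]≔ lookup y (fromℕ< p)
splice-suc {k = k} p y x = lookup-ext pointwise
  where
  open ≡-Reasoning
  toℕp≡k : toℕ (fromℕ< p) ≡ k
  toℕp≡k = toℕ-fromℕ< p

  pointwise : ∀ i → lookup (splice (suc k) y x) i ≡ lookup (splice k y x [ fromℕ< p ]≔ lookup y (fromℕ< p)) i
  pointwise i with <-cmp (toℕ i) k
  ... | tri< i<k _ _ = begin
    lookup (splice (suc k) y x) i ≡⟨ lookup-splice-< y x (m<n⇒m<1+n i<k) ⟩
    lookup y i                    ≡⟨ lookup-splice-< y x i<k ⟨
    lookup (splice k y x) i       ≡⟨ lookup∘update′ (λ i≡p → <-irrefl (trans (cong toℕ i≡p) toℕp≡k) i<k)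
                                                     (splice k y x) _ ⟨
    _                             ∎
  ... | tri≈ _ i≡k _ rewrite toℕ-injective (trans i≡k (sym toℕp≡k)) = begin
    lookup (splice (suc k) y x) (fromℕ< p) ≡⟨ lookup-splice-< y x (≤-reflexive (cong suc toℕp≡k)) ⟩
    lookup y (fromℕ< p)                    ≡⟨ lookup∘update (fromℕ< p) (splice k y x) _ ⟨
    _                                      ∎
  ... | tri> _ _ k<i = begin
    lookup (splice (suc k) y x) i ≡⟨ lookup-splice-≥ y x k<i ⟩
    lookup x i                    ≡⟨ lookup-splice-≥ y x (<⇒≤ k<i) ⟨
    lookup (splice k y x) i       ≡⟨ lookup∘update′ (λ i≡p → <-irrefl (sym (trans (cong toℕ i≡p) toℕp≡k)) k<i)
                                                     (splice k y x) _ ⟨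
    _                             ∎

splice-agree : ∀ {k} (p : k < n) (y x : Vec Bool n) → lookup y (fromℕ< p) ≡ lookup x (fromℕ< p) →
               splice (suc k) y x ≡ splice k y x
splice-agree {k = k} p y x y≡x = begin
  splice (suc k) y x                                           ≡⟨ splice-suc p y x ⟩
  splice k y x [ fromℕ< p ]≔ lookup y (fromℕ< p)               ≡⟨ cong (splice k y x [ fromℕ< p ]≔_) y≡splice ⟩
  splice k y x [ fromℕ< p ]≔ lookup (splice k y x) (fromℕ< p) ≡⟨ []≔-lookup (splice k y x) (fromℕ< p) ⟩
  splice k y x                                                 ∎
  where
  open ≡-Reasoning
  y≡splice : lookup y (fromℕ< p) ≡ lookup (splice k y x) (fromℕ< p)
  y≡splice = trans y≡x (sym (lookup-splice-≥ y x (≤-reflexive (sym (toℕ-fromℕ< p)))))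

splice-complement : ∀ k (x : Vec Bool n) → splice k (complement x) x ≡ x ⊕ prefix k
splice-complement k x = lookup-ext pointwise
  where
  pointwise : ∀ i → lookup (splice k (complement x) x) i ≡ lookup (x ⊕ prefix k) i
  pointwise i rewrite lookup-⊕ x (prefix k) i | lookup-prefix k i with toℕ i <? k
  ... | yes i<k rewrite <ᵇ-true i<k =
    trans (lookup-splice-< (complement x) x i<k) (trans (lookup-map i not x) (sym (xor-comm (lookup x i) true)))
  ... | no  i≮k rewrite <ᵇ-false (≮⇒≥ i≮k) =
    trans (lookup-splice-≥ (complement x) x (≮⇒≥ i≮k)) (sym (xor-identityʳ (lookup x i)))

module _ (f : Vec Bool n → Bool) where

  IsSDSImage : Vec Bool n → Vec Bool n → Set
  IsSDSImage x y = ∀ i → f (splice (toℕ i) y x) ≡ lookup y i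

  image-at : ∀ {x y k} → IsSDSImage x y → (p : k < n) → f (splice k y x) ≡ lookup y (fromℕ< p)
  image-at {x} {y} h p = subst (λ j → f (splice j y x) ≡ lookup y (fromℕ< p)) (toℕ-fromℕ< p) (h (fromℕ< p))

  seqUpdate-cong : ∀ {k k'} (p : k ≤ n) (q : k' ≤ n) x → k ≡ k' → seqUpdate f k p x ≡ seqUpdate f k' q x
  seqUpdate-cong p q x refl = cong (λ r → seqUpdate f _ r x) (≤-irrelevant p q)

  seqUpdate-suc : ∀ {k} (p : k < n) y x → seqUpdate f k (<⇒≤ p) x ≡ splice k y x →
                  f (splice k y x) ≡ lookup y (fromℕ< p) → seqUpdate f (suc k) p x ≡ splice (suc k) y x
  seqUpdate-suc {k} p y x eq fy = begin
    seqUpdate f (suc k) p x                        ≡⟨ cong (λ s → s [ fromℕ< p ]≔ f s) eq ⟩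
    splice k y x [ fromℕ< p ]≔ f (splice k y x)   ≡⟨ cong (splice k y x [ fromℕ< p ]≔_) fy ⟩
    splice k y x [ fromℕ< p ]≔ lookup y (fromℕ< p) ≡⟨ splice-suc p y x ⟨
    splice (suc k) y x                             ∎
    where open ≡-Reasoning

  image⇒SDS : ∀ {x y} → IsSDSImage x y → SDS f x ≡ y
  image⇒SDS {x} {y} h = trans (sweep n ≤-refl) (splice-all y x)
    where
    sweep : ∀ k (p : k ≤ n) → seqUpdate f k p x ≡ splice k y x
    sweep zero    p = sym (splice-zero y x)
    sweep (suc k) p = seqUpdate-suc p y x (sweep k (<⇒≤ p)) (image-at {x} {y} h p)

  SDS-image : ∀ x → IsSDSImage x (SDS f x)
  SDS-image x = subst (IsSDSImage x) (sym SDS≡written) written-image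
    where
    written : Vec Bool n
    written = tabulate λ i → f (seqUpdate f (toℕ i) (<⇒≤ (toℕ<n i)) x)

    sweep : ∀ k (p : k ≤ n) → seqUpdate f k p x ≡ splice k written x
    sweep zero    p = sym (splice-zero written x)
    sweep (suc k) p = seqUpdate-suc p written x (sweep k (<⇒≤ p)) (begin
      f (splice k written x)               ≡⟨ cong f (sweep k (<⇒≤ p)) ⟨
      f (seqUpdate f k (<⇒≤ p) x)          ≡⟨ cong f (seqUpdate-cong _ _ x (sym (toℕ-fromℕ< p))) ⟩
      f (seqUpdate f (toℕ (fromℕ< p)) _ x) ≡⟨ lookup∘tabulate _ (fromℕ< p) ⟨
      lookup written (fromℕ< p)            ∎)
      where open ≡-Reasoning

    SDS≡written : SDS f x ≡ written
    SDS≡written = trans (sweep n ≤-refl) (splice-all written x)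

    written-image : IsSDSImage x written
    written-image i = trans (cong f (sym (sweep (toℕ i) _))) (sym (lookup∘tabulate _ i))

-- Two-cycles

module _ {m : ℕ} (f : Vec Bool (suc m) → Bool) where

  private
    last : Fin (suc m)
    last = fromℕ< (n<1+n m)

  mutual-image-head : ∀ {x y} → IsSDSImage f x y → IsSDSImage f y x →
                      lookup x last ≡ lookup y last → lookup y fzero ≡ lookup x last
  mutual-image-head {x} {y} x→y y→x x≡y = begin
    lookup y fzero         ≡⟨ x→y fzero ⟨
    f (splice 0 y x)       ≡⟨ cong f (splice-zero y x) ⟩
    f x                    ≡⟨ cong f (splice-all x y) ⟨
    f (splice (suc m) x y) ≡⟨ cong f (splice-agree (n<1+n m) x y x≡y) ⟩
    f (splice m x y)       ≡⟨ image-at f {y} {x} y→x (n<1+n m) ⟩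
    lookup x last          ∎
    where open ≡-Reasoning

  mutual-images-disagree : ∀ {x y} → IsSDSImage f x y → IsSDSImage f y x → x ≢ y → ∀ i → lookup x i ≢ lookup y i
  mutual-images-disagree {x} {y} x→y y→x x≢y i xᵢ≡yᵢ =
    x≢y (lookup-ext λ j → agreeAt⁻¹ j (agree-up z≤n (agree-first agree-last)))
    where
    open ≡-Reasoning

    Agree : ℕ → Set
    Agree k = (p : k < suc m) → lookup x (fromℕ< p) ≡ lookup y (fromℕ< p)

    agreeAt : ∀ j → lookup x j ≡ lookup y j → Agree (toℕ j)
    agreeAt j e p = subst (λ j' → lookup x j' ≡ lookup y j') (sym (fromℕ<-toℕ j p)) e

    agreeAt⁻¹ : ∀ j → Agree (toℕ j) → lookup x j ≡ lookup y j
    agreeAt⁻¹ j a = subst (λ j' → lookup x j' ≡ lookup y j') (fromℕ<-toℕ j (toℕ<n j)) (a (toℕ<n j))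

    agree-suc : ∀ {k} → Agree k → Agree (suc k)
    agree-suc {k} a p = begin
      lookup x (fromℕ< p)    ≡⟨ image-at f {y} {x} y→x p ⟨
      f (splice (suc k) x y) ≡⟨ cong f (splice-agree k<n x y (a k<n)) ⟩
      f (splice k x y)       ≡⟨ image-at f {y} {x} y→x k<n ⟩
      lookup x (fromℕ< k<n)  ≡⟨ a k<n ⟩
      lookup y (fromℕ< k<n)  ≡⟨ image-at f {x} {y} x→y k<n ⟨
      f (splice k y x)       ≡⟨ cong f (splice-agree k<n y x (sym (a k<n))) ⟨
      f (splice (suc k) y x) ≡⟨ image-at f {x} {y} x→y p ⟩
      lookup y (fromℕ< p)    ∎
      where
      k<n : k < suc m
      k<n = <-trans (n<1+n k) p

    agree-up : ∀ {k j} → k ≤ j → Agree k → Agree j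
    agree-up {j = zero}  z≤n a = a
    agree-up {j = suc j} k≤j a with m≤n⇒m<n∨m≡n k≤j
    ... | inj₁ k<1+j = agree-suc (agree-up (≤-pred k<1+j) a)
    ... | inj₂ refl  = a

    agree-first : Agree m → Agree 0
    agree-first a _ = begin
      lookup x fzero ≡⟨ mutual-image-head {y} {x} y→x x→y (sym (a (n<1+n m))) ⟩
      lookup y last  ≡⟨ a (n<1+n m) ⟨
      lookup x last  ≡⟨ mutual-image-head {x} {y} x→y y→x (a (n<1+n m)) ⟨
      lookup y fzero ∎

    agree-last : Agree m
    agree-last = agree-up (≤-pred (toℕ<n i)) (agreeAt i xᵢ≡yᵢ)

  twoCycle⇒complement : ∀ x → OnTwoCycle (SDS f) x → SDS f x ≡ complement x
  twoCycle⇒complement x (Fx≢x , FFx≡x) = lookup-ext λ i →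
    trans (¬-not λ Fxᵢ≡xᵢ → mutual-images-disagree x→Fx Fx→x (≢-sym Fx≢x) i (sym Fxᵢ≡xᵢ)) (sym (lookup-map i not x))
    where
    x→Fx : IsSDSImage f x (SDS f x)
    x→Fx = SDS-image f x
    Fx→x : IsSDSImage f (SDS f x) x
    Fx→x = subst (IsSDSImage f (SDS f x)) FFx≡x (SDS-image f (SDS f x))

module _ (f : Vec Bool n → Bool) where

  Flips : Vec Bool n → Set
  Flips x = ∀ i → f (x ⊕ prefix (toℕ i)) ≡ not (lookup x i)

  image⇒flips : ∀ x → IsSDSImage f x (complement x) → Flips x
  image⇒flips x h i = trans (cong f (sym (splice-complement (toℕ i) x))) (trans (h i) (lookup-map i not x))

  flips⇒image : ∀ x → Flips x → IsSDSImage f x (complement x)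
  flips⇒image x h i = trans (cong f (splice-complement (toℕ i) x)) (trans (h i) (sym (lookup-map i not x)))

  flips-at : ∀ {z k} → Flips z → (p : k < n) → f (z ⊕ prefix k) ≡ not (lookup z (fromℕ< p))
  flips-at {z} φ p = subst (λ k → f (z ⊕ prefix k) ≡ not (lookup z (fromℕ< p))) (toℕ-fromℕ< p) (φ (fromℕ< p))

  flips-collision : ∀ {z w k k'} → Flips z → Flips w → (p : k < n) (q : k' < n) →
                    z ⊕ prefix k ≡ w ⊕ prefix k' → lookup z (fromℕ< p) ≡ lookup w (fromℕ< q)
  flips-collision φ ψ p q eq = not-injective (trans (sym (flips-at φ p)) (trans (cong f eq) (flips-at ψ q)))

module _ {m : ℕ} (f : Vec Bool (suc m) → Bool) where

  twoCycle⇒flips : ∀ x → OnTwoCycle (SDS f) x → Flips f x × Flips f (complement x)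
  twoCycle⇒flips x cycle@(_ , FFx≡x) =
    image⇒flips f x (subst (IsSDSImage f x) Fx≡x̄ (SDS-image f x)) ,
    image⇒flips f x̄ (subst (IsSDSImage f x̄) Fx̄≡x (SDS-image f x̄))
    where
    x̄ : Vec Bool (suc m)
    x̄ = complement x
    Fx≡x̄ : SDS f x ≡ x̄
    Fx≡x̄ = twoCycle⇒complement f x cycle
    Fx̄≡x : SDS f x̄ ≡ complement x̄
    Fx̄≡x = trans (cong (SDS f) (sym Fx≡x̄)) (trans FFx≡x (sym (complement-involutive x)))

  flips⇒twoCycle : ∀ x → Flips f x → Flips f (complement x) → OnTwoCycle (SDS f) x
  flips⇒twoCycle x φ φ̄ =
    (λ Fx≡x → complement-≢ x (trans (sym Fx≡x̄) Fx≡x)) ,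
    trans (cong (SDS f) Fx≡x̄) (trans (image⇒SDS f (flips⇒image f (complement x) φ̄)) (complement-involutive x))
    where
    Fx≡x̄ : SDS f x ≡ complement x
    Fx≡x̄ = image⇒SDS f (flips⇒image f x φ)

  twoCycle-complement : ∀ x → OnTwoCycle (SDS f) x → OnTwoCycle (SDS f) (complement x)
  twoCycle-complement x cycle =
    flips⇒twoCycle (complement x) (proj₂ (twoCycle⇒flips x cycle))
      (subst (Flips f) (sym (complement-involutive x)) (proj₁ (twoCycle⇒flips x cycle)))

module _ {m : ℕ} (f : Vec Bool (suc m) → Bool) where

  -- If x ⊕ y = [a, b) with 0 < a < b, then x ⊕ [0,a) = y ⊕ [0,b) and x ⊕ [0,b) = y ⊕ [0,a), where
  -- z ⊕ [0,n) is the state ¬z ⊕ [0,0); the values of f at these states force x_a = y_a.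
  flips⇒contains101 : ∀ {x y} → Flips f x → Flips f (complement x) → Flips f y → Flips f (complement y) →
                      lookup x fzero ≡ false → lookup y fzero ≡ false → x ≢ y → Contains101 (x ⊕ y)
  flips⇒contains101 {x} {y} φ φ̄ ψ ψ̄ x₀ y₀ x≢y with contains101-or-interval (x ⊕ y)
  ... | inj₁ c = c
  ... | inj₂ (a , b , a≤b , b≤n , x⊕y≡) = ⊥-elim (interval-impossible a≤b b≤n)
    where
    open ≡-Reasoning

    x⊕y≡′ : x ⊕ y ≡ prefix b ⊕ prefix a
    x⊕y≡′ = trans x⊕y≡ (⊕-comm (prefix a) (prefix b))

    x⊕y-at : ∀ {k} (p : k < suc m) → lookup x (fromℕ< p) xor lookup y (fromℕ< p) ≡ (k <ᵇ a) xor (k <ᵇ b)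
    x⊕y-at p = trans (sym (lookup-⊕ x y _))
                     (trans (cong (λ v → lookup v (fromℕ< p)) x⊕y≡) (lookup-interval-fromℕ< a b p))

    differ-at-a : a < b → (p : a < suc m) → lookup x (fromℕ< p) ≢ lookup y (fromℕ< p)
    differ-at-a a<b p = xor≡true⇒≢ (trans (x⊕y-at p) (cong₂ _xor_ (<ᵇ-false (≤-refl {a})) (<ᵇ-true a<b)))

    interval-impossible : a ≤ b → b ≤ suc m → ⊥
    interval-impossible a≤b b≤n with m≤n⇒m<n∨m≡n a≤b
    ... | inj₂ a≡b =
      x≢y (⊕≡zero⇒≡ (trans x⊕y≡ (trans (cong (λ k → prefix a ⊕ prefix k) (sym a≡b)) (⊕-self (prefix a)))))
    ... | inj₁ a<b with 0 <? a | m≤n⇒m<n∨m≡n b≤n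
    ...   | no 0≮a | _ = false≢true (begin
      false                 ≡⟨ cong₂ _xor_ x₀ y₀ ⟨
      lookup x fzero xor lookup y fzero ≡⟨ x⊕y-at (s≤s z≤n) ⟩
      (0 <ᵇ a) xor (0 <ᵇ b) ≡⟨ cong₂ _xor_ (<ᵇ-false (≮⇒≥ 0≮a)) (<ᵇ-true (≤-<-trans z≤n a<b)) ⟩
      true                  ∎)
    ...   | yes _ | inj₁ b<n = differ-at-a a<b a<n (begin
      lookup x (fromℕ< a<n) ≡⟨ flips-collision f φ ψ a<n b<n (⊕-swap x⊕y≡) ⟩
      lookup y (fromℕ< b<n) ≡⟨ xor≡false⇒≡ (trans (x⊕y-at b<n)
                                 (cong₂ _xor_ (<ᵇ-false (<⇒≤ a<b)) (<ᵇ-false (≤-refl {b})))) ⟨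
      lookup x (fromℕ< b<n) ≡⟨ flips-collision f φ ψ b<n a<n (⊕-swap x⊕y≡′) ⟩
      lookup y (fromℕ< a<n) ∎)
      where
      a<n : a < suc m
      a<n = <-trans a<b b<n
    ...   | yes _ | inj₂ b≡n = differ-at-a a<b a<n (begin
      lookup x (fromℕ< a<n)       ≡⟨ flips-collision f φ ψ̄ a<n (s≤s z≤n) (trans (⊕-swap x⊕y≡) (wrap y)) ⟩
      lookup (complement y) fzero ≡⟨ lookup-map fzero not y ⟩
      not (lookup y fzero)        ≡⟨ cong not (trans y₀ (sym x₀)) ⟩
      not (lookup x fzero)        ≡⟨ lookup-map fzero not x ⟨
      lookup (complement x) fzero ≡⟨ flips-collision f φ̄ ψ (s≤s z≤n) a<n
                                       (trans (sym (wrap x)) (⊕-swap x⊕y≡′)) ⟩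
      lookup y (fromℕ< a<n)       ∎)
      where
      a<n : a < suc m
      a<n = subst (a <_) b≡n a<b
      wrap : ∀ z → z ⊕ prefix b ≡ complement z ⊕ prefix 0
      wrap z = trans (cong (λ k → z ⊕ prefix k) b≡n) (trans (⊕-prefix-all z) (sym (⊕-prefix-zero (complement z))))

-- Realising the two-cycles of a clique

vertex-head : ∀ {m} {x : Vec Bool (suc m)} → IsVertex x → lookup x fzero ≡ false
vertex-head v = v fzero refl

head-vertex : ∀ {m} {x : Vec Bool (suc m)} → lookup x fzero ≡ false → IsVertex x
head-vertex {x = x} x₀ i i≡0 = subst (λ j → lookup x j ≡ false) (sym (toℕ-injective i≡0)) x₀

allPairs-∈ : ∀ {A : Set} {R : A → A → Set} {xs x y} →
             AllPairs R xs → x ∈ xs → y ∈ xs → x ≢ y → R x y ⊎ R y x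
allPairs-∈ (_  ∷ _)  (here refl) (here refl) x≢y = ⊥-elim (x≢y refl)
allPairs-∈ (Rx ∷ _)  (here refl) (there y∈)  _   = inj₁ (All.lookup Rx y∈)
allPairs-∈ (Rx ∷ _)  (there x∈)  (here refl) _   = inj₂ (All.lookup Rx x∈)
allPairs-∈ (_  ∷ Rs) (there x∈)  (there y∈)  x≢y = allPairs-∈ Rs x∈ y∈ x≢y

clique-contains101 : ∀ {c : List (Vec Bool n)} {x y} → IsClique c → x ∈ c → y ∈ c → x ≢ y → Contains101 (x ⊕ y)
clique-contains101 {x = x} {y} (_ , _ , adjacent) x∈ y∈ x≢y with allPairs-∈ adjacent x∈ y∈ x≢y
... | inj₁ (_ , c) = c
... | inj₂ (_ , c) = subst Contains101 (⊕-comm y x) c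

withComplements : List (Vec Bool n) → List (Vec Bool n)
withComplements c = c ++ List.map complement c

∈-withComplements⁻ : ∀ {c : List (Vec Bool n)} {z} → z ∈ withComplements c →
                     Σ (Vec Bool n) λ x → x ∈ c × Σ Bool λ b → ∀ i → lookup z i ≡ b xor lookup x i
∈-withComplements⁻ {c = c} z∈ with ∈-++⁻ c z∈
... | inj₁ z∈c = _ , z∈c , false , λ i → refl
... | inj₂ z∈c̄ with ∈-map⁻ complement z∈c̄
...   | x , x∈c , refl = x , x∈c , true , λ i → lookup-map i not x

complement-∈-withComplements : ∀ {c : List (Vec Bool n)} {z} → z ∈ withComplements c → complement z ∈ withComplements c
complement-∈-withComplements {c = c} z∈ with ∈-++⁻ c z∈
... | inj₁ z∈c = ∈-++⁺ʳ c (∈-map⁺ complement z∈c)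
... | inj₂ z∈c̄ with ∈-map⁻ complement z∈c̄
...   | x , x∈c , refl = ∈-++⁺ˡ (subst (_∈ c) (sym (complement-involutive x)) x∈c)

interval-empty⇒≡ : ∀ {i j : Fin n} → (∀ k → (toℕ k <ᵇ toℕ i) xor (toℕ k <ᵇ toℕ j) ≡ false) → i ≡ j
interval-empty⇒≡ {i = i} {j} empty with <-cmp (toℕ i) (toℕ j)
... | tri< i<j _ _ =
  ⊥-elim $ false≢true (trans (sym (empty i)) (cong₂ _xor_ (<ᵇ-false (≤-refl {toℕ i})) (<ᵇ-true i<j)))
... | tri≈ _ i≡j _ = toℕ-injective i≡j
... | tri> _ _ j<i =
  ⊥-elim $ false≢true (trans (sym (empty j)) (cong₂ _xor_ (<ᵇ-true j<i) (<ᵇ-false (≤-refl {toℕ j}))))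

module _ {m : ℕ} {c : List (Vec Bool (suc m))} (clique : IsClique c) where

  -- x ⊕ x′ is [i, j) up to complement, hence free of 101, so x = x′; then the offset is constant, forcing i = j.
  withComplements-states-injective : ∀ {z w i j} → z ∈ withComplements c → w ∈ withComplements c →
                                     z ⊕ prefix (toℕ i) ≡ w ⊕ prefix (toℕ j) → z ≡ w × i ≡ j
  withComplements-states-injective {z} {w} {i} {j} z∈ w∈ eq with ∈-withComplements⁻ z∈ | ∈-withComplements⁻ w∈
  ... | x , x∈ , b , z≡ | x' , x'∈ , b' , w≡ =
    lookup-ext (λ k → trans (z≡ k) (trans (cong₂ _xor_ b≡b' (cong (λ v → lookup v k) x≡x')) (sym (w≡ k)))) ,
    interval-empty⇒≡ G≡false
    where
    open ≡-Reasoning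

    G : Fin (suc m) → Bool
    G k = (toℕ k <ᵇ toℕ i) xor (toℕ k <ᵇ toℕ j)

    offset : ∀ k → lookup (x ⊕ x') k ≡ (b xor b') xor G k
    offset k = trans (lookup-⊕ x x' k)
      (xor-difference b (lookup x k) (toℕ k <ᵇ toℕ i) b' (lookup x' k) (toℕ k <ᵇ toℕ j) (begin
      (b xor lookup x k) xor (toℕ k <ᵇ toℕ i)   ≡⟨ cong₂ _xor_ (z≡ k) (lookup-prefix (toℕ i) k) ⟨
      lookup z k xor lookup (prefix (toℕ i)) k ≡⟨ lookup-⊕ z _ k ⟨
      lookup (z ⊕ prefix (toℕ i)) k            ≡⟨ cong (λ v → lookup v k) eq ⟩
      lookup (w ⊕ prefix (toℕ j)) k            ≡⟨ lookup-⊕ w _ k ⟩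
      lookup w k xor lookup (prefix (toℕ j)) k ≡⟨ cong₂ _xor_ (w≡ k) (lookup-prefix (toℕ j) k) ⟩
      (b' xor lookup x' k) xor (toℕ k <ᵇ toℕ j) ∎))

    x≡x' : x ≡ x'
    x≡x' with x ≟v x'
    ... | yes x≡x' = x≡x'
    ... | no  x≢x' = ⊥-elim (no101-of-two-cuts (x ⊕ x') (b xor b') (toℕ i) (toℕ j) offset
      (trans (lookup-⊕ x x' fzero) (cong₂ _xor_ (vertex-head {x = x} (All.lookup (proj₁ clique) x∈))
                                                 (vertex-head {x = x'} (All.lookup (proj₁ clique) x'∈))))
      (clique-contains101 clique x∈ x'∈ x≢x'))

    offset-zero : ∀ k → (b xor b') xor G k ≡ false
    offset-zero k = begin
      (b xor b') xor G k         ≡⟨ offset k ⟨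
      lookup (x ⊕ x') k          ≡⟨ lookup-⊕ x x' k ⟩
      lookup x k xor lookup x' k ≡⟨ cong (λ v → lookup x k xor lookup v k) x≡x' ⟨
      lookup x k xor lookup x k  ≡⟨ xor-same (lookup x k) ⟩
      false                      ∎

    G-last : G (fromℕ m) ≡ false
    G-last rewrite toℕ-fromℕ m = cong₂ _xor_ (<ᵇ-false (≤-pred (toℕ<n i))) (<ᵇ-false (≤-pred (toℕ<n j)))

    b≡b' : b ≡ b'
    b≡b' = xor≡false⇒≡ (trans (sym (xor-identityʳ (b xor b')))
                               (trans (cong ((b xor b') xor_) (sym G-last)) (offset-zero (fromℕ m))))

    G≡false : ∀ k → G k ≡ false
    G≡false k = trans (cong (_xor G k) (sym (trans (cong (b xor_) (sym b≡b')) (xor-same b)))) (offset-zero k)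

module _ {m : ℕ} (c : List (Vec Bool (suc m))) where

  -- s is a state z ⊕ [0,i) of the cycle through z at which the value ¬ z_i = 1 is written.
  WritesOne : Vec Bool (suc m) → Vec Bool (suc m) → Set
  WritesOne s z = Σ (Fin (suc m)) λ i → s ≡ z ⊕ prefix (toℕ i) × lookup z i ≡ false

  writesOne? : ∀ s → Dec (Any (WritesOne s) (withComplements c))
  writesOne? s =
    any? (λ z → Fin.any? λ i → (s ≟v (z ⊕ prefix (toℕ i))) ×-dec (lookup z i Bool.≟ false)) (withComplements c)

  cliqueFunction : Vec Bool (suc m) → Bool
  cliqueFunction s = does (writesOne? s)

  cliqueFunction-flips : IsClique c → ∀ {z} → z ∈ withComplements c → Flips cliqueFunction z
  cliqueFunction-flips clique {z} z∈ i with lookup z i in zᵢ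
  ... | false = dec-true (writesOne? _) (lose z∈ (i , refl , zᵢ))
  ... | true  = dec-false (writesOne? _) λ writes → case find writes of λ where
    (w , w∈ , j , eq , wⱼ) → case withComplements-states-injective clique {i = i} {j = j} z∈ w∈ eq of λ where
      (refl , refl) → false≢true (trans (sym wⱼ) zᵢ)

unique-⊆⇒length-≤ : ∀ {A : Set} {xs ys : List A} →
                    Unique xs → (∀ {v} → v ∈ xs → v ∈ ys) → length xs ≤ length ys
unique-⊆⇒length-≤ {xs = []} _ _ = z≤n
unique-⊆⇒length-≤ {xs = x ∷ xs} (x∉xs ∷ unique) xs⊆ys with ∈-∃++ (xs⊆ys (here refl))
... | us , vs , refl = begin
  suc (length xs)             ≤⟨ s≤s (unique-⊆⇒length-≤ unique xs⊆us++vs) ⟩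
  suc (length (us ++ vs))     ≡⟨ cong suc (length-++ us) ⟩
  suc (length us + length vs) ≡⟨ +-suc (length us) (length vs) ⟨
  length us + length (x ∷ vs) ≡⟨ length-++ us ⟨
  length (us ++ x ∷ vs)       ∎
  where
  open ≤-Reasoning
  xs⊆us++vs : ∀ {v} → v ∈ xs → v ∈ us ++ vs
  xs⊆us++vs v∈xs with ∈-++⁻ us (xs⊆ys (there v∈xs))
  ... | inj₁ v∈us         = ∈-++⁺ˡ v∈us
  ... | inj₂ (here refl)  = ⊥-elim (All.lookup x∉xs v∈xs refl)
  ... | inj₂ (there v∈vs) = ∈-++⁺ʳ us v∈vs

allPairs-intro : ∀ {A : Set} {P : A → Set} {R : A → A → Set} {xs} →
                 (∀ {x y} → P x → P y → x ≢ y → R x y) → All P xs → Unique xs → AllPairs R xs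
allPairs-intro r [] [] = []
allPairs-intro r (px ∷ pxs) (x≢xs ∷ unique) =
  All.zipWith (λ (py , x≢y) → r px py x≢y) (pxs , x≢xs) ∷ allPairs-intro r pxs unique

∈-allVecs : ∀ n (v : Vec Bool n) → v ∈ allVecs n
∈-allVecs zero    []          = here refl
∈-allVecs (suc n) (false ∷ v) = ∈-++⁺ˡ (∈-map⁺ (false ∷_) (∈-allVecs n v))
∈-allVecs (suc n) (true ∷ v)  = ∈-++⁺ʳ _ (∈-map⁺ (true ∷_) (∈-allVecs n v))

allVecs-unique : ∀ n → Unique (allVecs n)
allVecs-unique zero    = [] ∷ []
allVecs-unique (suc n) =
  Unique.++⁺ (Unique.map⁺ ∷-injectiveʳ (allVecs-unique n)) (Unique.map⁺ ∷-injectiveʳ (allVecs-unique n)) heads-differ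
  where
  heads-differ : ∀ {v} → ¬ (v ∈ List.map (false ∷_) (allVecs n) × v ∈ List.map (true ∷_) (allVecs n))
  heads-differ (v∈₀ , v∈₁) with ∈-map⁻ (false ∷_) v∈₀ | ∈-map⁻ (true ∷_) v∈₁
  ... | _ , _ , refl | _ , _ , ()

m+m≡m*2 : ∀ m → m + m ≡ m * 2
m+m≡m*2 m = trans (cong (m +_) (sym (+-identityʳ m))) (*-comm 2 m)

double≤⇒≤half : ∀ {m k} → m + m ≤ k → m ≤ k / 2
double≤⇒≤half {m} {k} h = begin
  m         ≡⟨ m*n/n≡m m 2 ⟨
  m * 2 / 2 ≤⟨ /-monoˡ-≤ 2 (subst (_≤ k) (m+m≡m*2 m) h) ⟩
  k / 2     ∎
  where open ≤-Reasoning

≤double⇒half≤ : ∀ {m k} → k ≤ m + m → k / 2 ≤ m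
≤double⇒half≤ {m} {k} h = begin
  k / 2     ≤⟨ /-monoˡ-≤ 2 (subst (k ≤_) (m+m≡m*2 m) h) ⟩
  m * 2 / 2 ≡⟨ m*n/n≡m m 2 ⟩
  m         ∎
  where open ≤-Reasoning

twoCyclePoints : (Vec Bool n → Bool) → List (Vec Bool n)
twoCyclePoints {n} f = filter (onTwoCycle? (SDS f)) (allVecs n)

length-withComplements : ∀ (c : List (Vec Bool n)) → length (withComplements c) ≡ length c + length c
length-withComplements c = trans (length-++ c) (cong (length c +_) (length-map complement c))

module _ {m : ℕ} {c : List (Vec Bool (suc m))} (clique : IsClique c) where

  withComplements-unique : Unique (withComplements c)
  withComplements-unique =
    Unique.++⁺ (proj₁ (proj₂ clique)) (Unique.map⁺ complement-injective (proj₁ (proj₂ clique))) vertices≠complements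
    where
    vertices≠complements : ∀ {v} → ¬ (v ∈ c × v ∈ List.map complement c)
    vertices≠complements (v∈c , v∈c̄) with ∈-map⁻ complement v∈c̄
    ... | x , x∈c , refl = false≢true (begin
      false                       ≡⟨ vertex-head {x = complement x} (All.lookup (proj₁ clique) v∈c) ⟨
      lookup (complement x) fzero ≡⟨ lookup-map fzero not x ⟩
      not (lookup x fzero)        ≡⟨ cong not (vertex-head {x = x} (All.lookup (proj₁ clique) x∈c)) ⟩
      true                        ∎)
      where open ≡-Reasoning

  clique≤eta : length c ≤ eta (cliqueFunction c)
  clique≤eta = double≤⇒≤half (subst (_≤ length (twoCyclePoints (cliqueFunction c))) (length-withComplements c)
    (unique-⊆⇒length-≤ withComplements-unique on-twoCycle))
    where
    on-twoCycle : ∀ {z} → z ∈ withComplements c → z ∈ twoCyclePoints (cliqueFunction c)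
    on-twoCycle {z} z∈ = ∈-filter⁺ (onTwoCycle? (SDS (cliqueFunction c))) (∈-allVecs _ z)
      (flips⇒twoCycle (cliqueFunction c) z (cliqueFunction-flips c clique z∈)
                                           (cliqueFunction-flips c clique (complement-∈-withComplements {c = c} z∈)))

module _ {m : ℕ} (f : Vec Bool (suc m) → Bool) where

  TwoCycleVertex : Vec Bool (suc m) → Set
  TwoCycleVertex v = lookup v fzero ≡ false × OnTwoCycle (SDS f) v

  twoCycleVertices : List (Vec Bool (suc m))
  twoCycleVertices = filter (λ v → (lookup v fzero Bool.≟ false) ×-dec onTwoCycle? (SDS f) v) (allVecs (suc m))

  twoCycleVertices-clique : IsClique twoCycleVertices
  twoCycleVertices-clique =
    All.map (λ {x} v → head-vertex {x = x} (proj₁ v)) vertices , unique , allPairs-intro adjacent vertices unique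
    where
    vertices : All TwoCycleVertex twoCycleVertices
    vertices = all-filter _ (allVecs (suc m))
    unique : Unique twoCycleVertices
    unique = Unique.filter⁺ _ (allVecs-unique (suc m))
    adjacent : ∀ {x y} → TwoCycleVertex x → TwoCycleVertex y → x ≢ y → Adj x y
    adjacent {x} {y} (x₀ , x-cycle) (y₀ , y-cycle) x≢y =
      x≢y , flips⇒contains101 f (proj₁ x-flips) (proj₂ x-flips) (proj₁ y-flips) (proj₂ y-flips) x₀ y₀ x≢y
      where
      x-flips : Flips f x × Flips f (complement x)
      x-flips = twoCycle⇒flips f x x-cycle
      y-flips : Flips f y × Flips f (complement y)
      y-flips = twoCycle⇒flips f y y-cycle

  eta≤twoCycleVertices : eta f ≤ length twoCycleVertices
  eta≤twoCycleVertices = ≤double⇒half≤ (subst (length (twoCyclePoints f) ≤_) (length-withComplements twoCycleVertices)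
    (unique-⊆⇒length-≤ (Unique.filter⁺ _ (allVecs-unique (suc m))) covered))
    where
    cover : ∀ {z} b → lookup z fzero ≡ b → OnTwoCycle (SDS f) z → z ∈ withComplements twoCycleVertices
    cover {z} false z₀ z-cycle = ∈-++⁺ˡ (∈-filter⁺ _ (∈-allVecs _ z) (z₀ , z-cycle))
    cover {z} true  z₀ z-cycle = ∈-++⁺ʳ twoCycleVertices (subst (_∈ _) (complement-involutive z)
      (∈-map⁺ complement (∈-filter⁺ _ (∈-allVecs _ (complement z))
        (trans (lookup-map fzero not z) (cong not z₀) , twoCycle-complement f z z-cycle))))

    covered : ∀ {z} → z ∈ twoCyclePoints f → z ∈ withComplements twoCycleVertices
    covered z∈ = cover _ refl (proj₂ (∈-filter⁻ (onTwoCycle? (SDS f)) {xs = allVecs (suc m)} z∈))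

listsUpTo : ∀ {A : Set} → ℕ → List A → List (List A)
listsUpTo zero    xs = [] ∷ []
listsUpTo (suc k) xs = [] ∷ concatMap (λ x → List.map (x ∷_) (listsUpTo k xs)) xs

∈-listsUpTo : ∀ {A : Set} {k} {xs ys : List A} → length ys ≤ k → All (_∈ xs) ys → ys ∈ listsUpTo k xs
∈-listsUpTo {k = zero}  {ys = []} _ _ = here refl
∈-listsUpTo {k = suc k} {ys = []} _ _ = here refl
∈-listsUpTo {k = suc k} {xs} {y ∷ ys} (s≤s ys≤k) (y∈xs ∷ ys⊆xs) =
  there (∈-concatMap⁺ (λ x → List.map (x ∷_) (listsUpTo k xs))
                      (lose y∈xs (∈-map⁺ (y ∷_) (∈-listsUpTo ys≤k ys⊆xs))))

contains101? : (e : Vec Bool n) → Dec (Contains101 e)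
contains101? e = Fin.any? λ i → Fin.any? λ j → Fin.any? λ k →
  (i Fin.<? j) ×-dec (j Fin.<? k) ×-dec
  (lookup e i Bool.≟ true) ×-dec (lookup e j Bool.≟ false) ×-dec (lookup e k Bool.≟ true)

isClique? : (c : List (Vec Bool n)) → Dec (IsClique c)
isClique? {n} c = All.all? vertex? c ×-dec AllPairs.allPairs? (λ x y → ¬? (x ≟v y)) c ×-dec AllPairs.allPairs? adj? c
  where
  vertex? : (x : Vec Bool n) → Dec (IsVertex x)
  vertex? x = Fin.all? λ i → (toℕ i ℕ.≟ 0) →-dec (lookup x i Bool.≟ false)
  adj? : (x y : Vec Bool n) → Dec (Adj x y)
  adj? x y = ¬? (x ≟v y) ×-dec contains101? (x ⊕ y)

cliqueNumber-exists : ∀ n → Σ ℕ (IsCliqueNumber n)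
cliqueNumber-exists n = length largest , (largest , largest-clique , refl) , maximal
  where
  candidates : List (List (Vec Bool n))
  candidates = listsUpTo (length (allVecs n)) (allVecs n)
  cliques : List (List (Vec Bool n))
  cliques = filter isClique? candidates
  largest : List (Vec Bool n)
  largest = argmax length [] cliques
  largest-clique : IsClique largest
  largest-clique = argmax-all length {xs = cliques} ([] , [] , []) (all-filter isClique? candidates)
  maximal : ∀ c → IsClique c → length c ≤ length largest
  maximal c clique = All.lookup (f[xs]≤f[argmax] [] cliques) (∈-filter⁺ isClique? c∈candidates clique)
    where
    c∈candidates : c ∈ candidates
    c∈candidates = ∈-listsUpTo (unique-⊆⇒length-≤ (proj₁ (proj₂ clique)) (λ {v} _ → ∈-allVecs n v))
                               (All.tabulate λ {v} _ → ∈-allVecs n v)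

etaMax≡cliqueNumber : ∀ m → Σ ℕ λ ω → IsEtaMax (suc m) ω × IsCliqueNumber (suc m) ω
etaMax≡cliqueNumber m with cliqueNumber-exists (suc m)
... | ω , largest@(c , clique , |c|≡ω) , maximal =
  ω , ((cliqueFunction c , ≤-antisym (eta≤ω (cliqueFunction c)) ω≤eta) , eta≤ω) , largest , maximal
  where
  eta≤ω : ∀ f → eta f ≤ ω
  eta≤ω f = ≤-trans (eta≤twoCycleVertices f) (maximal _ (twoCycleVertices-clique f))
  ω≤eta : ω ≤ eta (cliqueFunction c)
  ω≤eta = subst (_≤ eta (cliqueFunction c)) |c|≡ω (clique≤eta clique)

theorem1 : (n : ℕ) → 2 ≤ n → Σ ℕ λ m → IsEtaMax n m × IsCliqueNumber n m
theorem1 zero    ()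
theorem1 (suc m) _ = etaMax≡cliqueNumber m
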